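{- The set MNF is closed under prefixing ordinal modalities modulo $\mathbf{TSC}$-equivalence: for every $\psi\in\mathrm{MNF}$, every $n<\omega$ and every $\alpha<\varepsilon_0$, there is $\psi'\in\mathrm{MNF}$ with $\langle n^\alpha\rangle\psi\equiv\psi'$.
   Context: Ordinals range below $\varepsilon_0$. $\mathbb{F}_{\varepsilon_0}$ is the least set containing $\top$, closed under $\wedge$ and under unary modalities $\langle n^\alpha\rangle$ ($n<\omega$, $\alpha<\varepsilon_0$); $\langle n^0\rangle\varphi$ denotes $\varphi$. Hyper-exponentials: $e^0=\mathrm{id}$, $e^1(\alpha)=-1+\omega^\alpha$, $e^{n+m}=e^n\circ e^m$. MNF is the least set with: $\top\in$ MNF; each monomial $\langle n^\alpha\rangle\top\in$ MNF; if $\langle n_0^{\alpha_0}\rangle\top\wedge\cdots\wedge\langle n_k^{\alpha_k}\rangle\top\in$ MNF, $n<n_0$, and $\alpha=e^{n_0-n}(\alpha_0)\cdot(2+\beta)$ for some $\beta<\varepsilon_0$, then $\langle n^\alpha\rangle\top\wedge\langle n_0^{\alpha_0}\rangle\top\wedge\cdots\wedge\langle n_k^{\alpha_k}\rangle\top\in$ MNF. $\mathbf{TSC}$ derives sequents $\varphi\vdash\psi$; $\varphi\equiv\psi$ means both directions derivable. Axioms: $\varphi\vdash\varphi$; $\varphi\vdash\top$; $\varphi\wedge\psi\vdash\varphi$; $\varphi\wedge\psi\vdash\psi$; $\langle n^\alpha\rangle\varphi\vdash\langle n^\beta\rangle\varphi$ for $\beta\le\alpha$; $\langle n^{\alpha+\beta}\rangle\varphi\equiv\langle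 n^\beta\rangle\langle n^\alpha\rangle\varphi$; $\langle(m+n)^\alpha\rangle\varphi\vdash\langle m^{e^n(\alpha)}\rangle\varphi$; Schmerl axioms $\langle n^\alpha\rangle(\langle n_0^{\alpha_0}\rangle\top\wedge\cdots\wedge\langle n_k^{\alpha_k}\rangle\top)\equiv\langle n^{e^{n_0-n}(\alpha_0)\cdot(1+\alpha)}\rangle\top\wedge\langle n_0^{\alpha_0}\rangle\top\wedge\cdots\wedge\langle n_k^{\alpha_k}\rangle\top$ for $n<n_0$ and the conjunction in MNF. Rules: from $\varphi\vdash\psi$, $\varphi\vdash\chi$ infer $\varphi\vdash\psi\wedge\chi$; from $\varphi\vdash\psi$, $\psi\vdash\chi$ infer $\varphi\vdash\chi$; from $\varphi\vdash\psi$ infer $\langle n^\alpha\rangle\varphi\vdash\langle n^\alpha\rangle\psi$; from $\varphi\vdash\psi$ infer $\langle n^\alpha\rangle\varphi\wedge\langle m^{\beta+1}\rangle\psi\vdash\langle n^\alpha\rangle(\varphi\wedge\langle m^{\beta+1}\rangle\psi)$ for $m<n$. -}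

module Defs where

open import Data.Nat using (ℕ; zero; suc; _∸_) renaming (_<_ to _<ℕ_; _+_ to _+ℕ_)
open import Data.Sum using (_⊎_)
open import Data.Product using (_×_)
open import Relation.Binary.PropositionalEquality using (_≡_; _≢_)

-- Genuine ordinals < ε₀ are exactly
-- the terms satisfying NF (exponents weakly decreasing); on NF terms
-- propositional equality is ordinal equality.

data Tm : Set where
  𝟎    : Tm
  ω^_+_ : Tm → Tm → Tm

data Cmp : Set where
  lt eq gt : Cmp

compare : Tm → Tm → Cmp
compare 𝟎 𝟎 = eq
compare 𝟎 (ω^ _ + _) = lt
compare (ω^ _ + _) 𝟎 = gt
compare (ω^ a + b) (ω^ c + d) with compare a c
... | lt = lt
... | gt = gt
... | eq = compare b d

-- ordinal order (correct on NF terms)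
_<ₒ_ : Tm → Tm → Set
a <ₒ b = compare a b ≡ lt

_≤ₒ_ : Tm → Tm → Set
a ≤ₒ b = (compare a b ≡ lt) ⊎ (compare a b ≡ eq)

data NF : Tm → Set where
  nf𝟎 : NF 𝟎
  nf₁ : ∀ {a} → NF a → NF (ω^ a + 𝟎)
  nf₂ : ∀ {a c d} → NF a → NF (ω^ c + d) → c ≤ₒ a → NF (ω^ a + (ω^ c + d))

_+ₒ_ : Tm → Tm → Tm
𝟎 +ₒ b = b
(ω^ a + x) +ₒ 𝟎 = ω^ a + x
(ω^ a + x) +ₒ (ω^ c + d) with compare a c
... | lt = ω^ c + d
... | _  = ω^ a + (x +ₒ (ω^ c + d))

-- α · ω^c
mulω : Tm → Tm → Tm
mulω 𝟎 c = 𝟎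
mulω (ω^ a + x) 𝟎 = ω^ a + x
mulω (ω^ a + x) (ω^ c + d) = ω^ (a +ₒ (ω^ c + d)) + 𝟎

-- ordinal multiplication (left distributivity over the CNF of the right factor)
_·ₒ_ : Tm → Tm → Tm
α ·ₒ 𝟎 = 𝟎
α ·ₒ (ω^ c + d) = mulω α c +ₒ (α ·ₒ d)

oneₒ twoₒ : Tm
oneₒ = ω^ 𝟎 + 𝟎
twoₒ = ω^ 𝟎 + oneₒ

-- e¹(α) = -1 + ω^α
e¹ : Tm → Tm
e¹ 𝟎 = 𝟎
e¹ (ω^ a + b) = ω^ (ω^ a + b) + 𝟎

e^ : ℕ → Tm → Tm
e^ zero α = α
e^ (suc n) α = e¹ (e^ n α)

data Fm : Set where
  ⊤'  : Fm
  _∧'_ : Fm → Fm → Fm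
  ◇   : ℕ → Tm → Fm → Fm

infixr 5 _∧'_

⟨_^_⟩_ : ℕ → Tm → Fm → Fm
⟨ n ^ 𝟎 ⟩ φ = φ
⟨ n ^ (ω^ a + b) ⟩ φ = ◇ n (ω^ a + b) φ

data WF : Fm → Set where
  wf⊤ : WF ⊤'
  wf∧ : ∀ {φ ψ} → WF φ → WF ψ → WF (φ ∧' ψ)
  wf◇ : ∀ {n a b φ} → NF (ω^ a + b) → WF φ → WF (◇ n (ω^ a + b) φ)

data HasHead : Fm → ℕ → Tm → Set where
  hd₁ : ∀ {n₀ α₀} → α₀ ≢ 𝟎 → HasHead (⟨ n₀ ^ α₀ ⟩ ⊤') n₀ α₀
  hd₂ : ∀ {n₀ α₀ ψ} → α₀ ≢ 𝟎 → HasHead ((⟨ n₀ ^ α₀ ⟩ ⊤') ∧' ψ) n₀ α₀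

data MNF : Fm → Set where
  top  : MNF ⊤'
  mono : ∀ {n α} → NF α → α ≢ 𝟎 → MNF (⟨ n ^ α ⟩ ⊤')
  ext  : ∀ {χ n n₀ α₀ β} → MNF χ → HasHead χ n₀ α₀ → n <ℕ n₀ → NF β →
         MNF ((⟨ n ^ (e^ (n₀ ∸ n) α₀ ·ₒ (twoₒ +ₒ β)) ⟩ ⊤') ∧' χ)

infix 3 _⊢_
data _⊢_ : Fm → Fm → Set where
  ax-id  : ∀ {φ} → WF φ → φ ⊢ φ
  ax-top : ∀ {φ} → WF φ → φ ⊢ ⊤'
  ax-∧l  : ∀ {φ ψ} → WF φ → WF ψ → φ ∧' ψ ⊢ φ
  ax-∧r  : ∀ {φ ψ} → WF φ → WF ψ → φ ∧' ψ ⊢ ψ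
  ax-mono : ∀ {n α β φ} → WF φ → NF α → NF β → β ≤ₒ α →
            ⟨ n ^ α ⟩ φ ⊢ ⟨ n ^ β ⟩ φ
  ax-add→ : ∀ {n α β φ} → WF φ → NF α → NF β →
            ⟨ n ^ (α +ₒ β) ⟩ φ ⊢ ⟨ n ^ β ⟩ (⟨ n ^ α ⟩ φ)
  ax-add← : ∀ {n α β φ} → WF φ → NF α → NF β →
            ⟨ n ^ β ⟩ (⟨ n ^ α ⟩ φ) ⊢ ⟨ n ^ (α +ₒ β) ⟩ φ
  ax-red : ∀ {m n α φ} → WF φ → NF α →
           ⟨ (m +ℕ n) ^ α ⟩ φ ⊢ ⟨ m ^ e^ n α ⟩ φ
  ax-sch→ : ∀ {χ n n₀ α₀ α} → MNF χ → HasHead χ n₀ α₀ → n <ℕ n₀ → NF α →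
            ⟨ n ^ α ⟩ χ ⊢ (⟨ n ^ (e^ (n₀ ∸ n) α₀ ·ₒ (oneₒ +ₒ α)) ⟩ ⊤') ∧' χ
  ax-sch← : ∀ {χ n n₀ α₀ α} → MNF χ → HasHead χ n₀ α₀ → n <ℕ n₀ → NF α →
            (⟨ n ^ (e^ (n₀ ∸ n) α₀ ·ₒ (oneₒ +ₒ α)) ⟩ ⊤') ∧' χ ⊢ ⟨ n ^ α ⟩ χ
  r-∧   : ∀ {φ ψ χ} → φ ⊢ ψ → φ ⊢ χ → φ ⊢ ψ ∧' χ
  r-cut : ∀ {φ ψ χ} → φ ⊢ ψ → ψ ⊢ χ → φ ⊢ χ
  r-◇   : ∀ {n α φ ψ} → NF α → φ ⊢ ψ → ⟨ n ^ α ⟩ φ ⊢ ⟨ n ^ α ⟩ ψ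
  r-pull : ∀ {m n α β φ ψ} → m <ℕ n → NF α → NF β → φ ⊢ ψ →
           (⟨ n ^ α ⟩ φ) ∧' (⟨ m ^ (β +ₒ oneₒ) ⟩ ψ) ⊢ ⟨ n ^ α ⟩ (φ ∧' (⟨ m ^ (β +ₒ oneₒ) ⟩ ψ))

_≡ᵀ_ : Fm → Fm → Set
φ ≡ᵀ ψ = (φ ⊢ ψ) × (ψ ⊢ φ)

-- Induction on the MNF ψ, comparing n with the index k of its head monomial ⟨k^B⟩⊤.
-- For n < k a Schmerl axiom applies directly. For n = k the head is first folded back,
-- by a Schmerl axiom, into a modality ⟨k^(1+δ)⟩ on the tail, and the two modalities add up.
-- For n > k the modality ⟨n^α⟩ moves past the head, which becomes ⟨k^(B+1)⟩⊤, and into the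
-- tail by induction. The monomial then meets the new head ⟨h^a⟩ of the tail and merges into
-- ⟨k^(ρ + ω^x)⟩⊤ with ρ = B + 1 and ω^x = e^(h-k)(a); ordinal arithmetic shows that ρ + ω^x is
-- either ω^x, making the monomial redundant, or ω^x · (2 + δ), the MNF side condition.

module Submission where

open import Defs
open import Data.Nat using (ℕ; zero; suc; _∸_; _<_; _≤_)
open import Data.Nat.Properties using (<-cmp; <-trans; <⇒≤; m+[n∸m]≡n; m<n⇒0<n∸m)
open import Data.Product using (Σ; Σ-syntax; _×_; _,_; swap)
open import Data.Sum using (_⊎_; inj₁; inj₂)
open import Data.Empty using (⊥-elim)
open import Relation.Nullary using (¬_)
open import Relation.Binary.Definitions using (tri<; tri≈; tri>)
open import Relation.Binary.PropositionalEquality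
  using (_≡_; _≢_; refl; sym; trans; cong; cong₂; subst; subst₂; module ≡-Reasoning)

eq≢lt : eq ≢ lt
eq≢lt ()

compare-refl : ∀ a → compare a a ≡ eq
compare-refl 𝟎 = refl
compare-refl (ω^ a + b) rewrite compare-refl a = compare-refl b

compare-eq⇒≡ : ∀ a b → compare a b ≡ eq → a ≡ b
compare-eq⇒≡ 𝟎 𝟎 _ = refl
compare-eq⇒≡ 𝟎 (ω^ _ + _) ()
compare-eq⇒≡ (ω^ _ + _) 𝟎 ()
compare-eq⇒≡ (ω^ a + b) (ω^ c + d) p with compare a c in q
compare-eq⇒≡ (ω^ a + b) (ω^ c + d) () | lt
compare-eq⇒≡ (ω^ a + b) (ω^ c + d) p  | eq = cong₂ ω^_+_ (compare-eq⇒≡ a c q) (compare-eq⇒≡ b d p)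
compare-eq⇒≡ (ω^ a + b) (ω^ c + d) () | gt

compare-eq-sym : ∀ a b → compare a b ≡ eq → compare b a ≡ eq
compare-eq-sym a b p rewrite compare-eq⇒≡ a b p = compare-refl b

compare-gt⇒lt : ∀ a b → compare a b ≡ gt → b <ₒ a
compare-gt⇒lt (ω^ _ + _) 𝟎 _ = refl
compare-gt⇒lt (ω^ a + b) (ω^ c + d) p  with compare a c in q
compare-gt⇒lt (ω^ a + b) (ω^ c + d) () | lt
compare-gt⇒lt (ω^ a + b) (ω^ c + d) p  | eq rewrite compare-eq-sym a c q = compare-gt⇒lt b d p
compare-gt⇒lt (ω^ a + b) (ω^ c + d) p  | gt rewrite compare-gt⇒lt a c q = refl

<ₒ-head : ∀ a b c d → a <ₒ c → (ω^ a + b) <ₒ (ω^ c + d)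
<ₒ-head a b c d a<c rewrite a<c = refl

<ₒ-tail : ∀ a b d → b <ₒ d → (ω^ a + b) <ₒ (ω^ a + d)
<ₒ-tail a b d b<d rewrite compare-refl a = b<d

<ₒ-ω^-inv : ∀ a b c d → (ω^ a + b) <ₒ (ω^ c + d) → a <ₒ c ⊎ (a ≡ c × b <ₒ d)
<ₒ-ω^-inv a b c d p with compare a c in q
... | lt = inj₁ refl
... | eq = inj₂ (compare-eq⇒≡ a c q , p)
<ₒ-ω^-inv a b c d () | gt

<ₒ-irrefl : ∀ a → ¬ a <ₒ a
<ₒ-irrefl a p = eq≢lt (trans (sym (compare-refl a)) p)

≮ₒ𝟎 : ∀ a → ¬ a <ₒ 𝟎
≮ₒ𝟎 𝟎 ()
≮ₒ𝟎 (ω^ _ + _) ()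

<ₒ-trans : ∀ a b c → a <ₒ b → b <ₒ c → a <ₒ c
<ₒ-trans 𝟎 (ω^ _ + _) (ω^ _ + _) _ _ = refl
<ₒ-trans 𝟎 (ω^ _ + _) 𝟎 _ ()
<ₒ-trans (ω^ _ + _) (ω^ _ + _) 𝟎 _ ()
<ₒ-trans (ω^ a + a′) (ω^ b + b′) (ω^ c + c′) p q with <ₒ-ω^-inv a a′ b b′ p | <ₒ-ω^-inv b b′ c c′ q
... | inj₁ a<b        | inj₁ b<c        = <ₒ-head a a′ c c′ (<ₒ-trans a b c a<b b<c)
... | inj₁ a<b        | inj₂ (refl , _) = <ₒ-head a a′ c c′ a<b
... | inj₂ (refl , _) | inj₁ b<c        = <ₒ-head a a′ c c′ b<c
... | inj₂ (refl , p′) | inj₂ (refl , q′) = <ₒ-tail a a′ c′ (<ₒ-trans a′ b′ c′ p′ q′)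

≤ₒ-refl : ∀ a → a ≤ₒ a
≤ₒ-refl a = inj₂ (compare-refl a)

𝟎≤ₒ : ∀ a → 𝟎 ≤ₒ a
𝟎≤ₒ 𝟎 = inj₂ refl
𝟎≤ₒ (ω^ _ + _) = inj₁ refl

≤ₒ-trans : ∀ a b c → a ≤ₒ b → b ≤ₒ c → a ≤ₒ c
≤ₒ-trans a b c (inj₁ a<b) (inj₁ b<c) = inj₁ (<ₒ-trans a b c a<b b<c)
≤ₒ-trans a b c (inj₁ a<b) (inj₂ b=c) rewrite sym (compare-eq⇒≡ b c b=c) = inj₁ a<b
≤ₒ-trans a b c (inj₂ a=b) b≤c rewrite compare-eq⇒≡ a b a=b = b≤c

≤ₒ⇒≯ₒ : ∀ a b → b ≤ₒ a → ¬ a <ₒ b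
≤ₒ⇒≯ₒ a b (inj₁ b<a) a<b = <ₒ-irrefl a (<ₒ-trans a b a a<b b<a)
≤ₒ⇒≯ₒ a b (inj₂ b=a) a<b rewrite compare-eq⇒≡ b a b=a = <ₒ-irrefl a a<b

<ₒ-dec : ∀ a b → a <ₒ b ⊎ b ≤ₒ a
<ₒ-dec a b with compare a b in q
... | lt = inj₁ refl
... | eq = inj₂ (inj₂ (compare-eq-sym a b q))
... | gt = inj₂ (inj₁ (compare-gt⇒lt a b q))

≤ₒ𝟎⇒≡𝟎 : ∀ a → a ≤ₒ 𝟎 → a ≡ 𝟎
≤ₒ𝟎⇒≡𝟎 𝟎 _ = refl
≤ₒ𝟎⇒≡𝟎 (ω^ _ + _) (inj₁ ())
≤ₒ𝟎⇒≡𝟎 (ω^ _ + _) (inj₂ ())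

-- The junk value lexp 𝟎 = 𝟎 makes "lexp t ≤ₒ a" read "t = 𝟎 or t's leading exponent is ≤ a".
lexp : Tm → Tm
lexp 𝟎 = 𝟎
lexp (ω^ a + _) = a

lexp-mono : ∀ c p → c <ₒ p → lexp c ≤ₒ lexp p
lexp-mono 𝟎 p _ = 𝟎≤ₒ (lexp p)
lexp-mono (ω^ c + c′) 𝟎 ()
lexp-mono (ω^ c + c′) (ω^ p + p′) c<p with <ₒ-ω^-inv c c′ p p′ c<p
... | inj₁ c<p′ = inj₁ c<p′
... | inj₂ (refl , _) = ≤ₒ-refl c

nf-head : ∀ {a t} → NF (ω^ a + t) → NF a
nf-head (nf₁ na) = na
nf-head (nf₂ na _ _) = na

nf-tail : ∀ {a t} → NF (ω^ a + t) → NF t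
nf-tail (nf₁ _) = nf𝟎
nf-tail (nf₂ _ nt _) = nt

nf-lexp : ∀ {a t} → NF (ω^ a + t) → lexp t ≤ₒ a
nf-lexp {a} (nf₁ _) = 𝟎≤ₒ a
nf-lexp (nf₂ _ _ c≤a) = c≤a

nf-ω^ : ∀ {a t} → NF a → NF t → lexp t ≤ₒ a → NF (ω^ a + t)
nf-ω^ na nf𝟎 _ = nf₁ na
nf-ω^ na nt@(nf₁ _) c≤a = nf₂ na nt c≤a
nf-ω^ na nt@(nf₂ _ _ _) c≤a = nf₂ na nt c≤a

nf-one : NF oneₒ
nf-one = nf₁ nf𝟎

nf-two : NF twoₒ
nf-two = nf₂ nf𝟎 nf-one (inj₂ refl)

+ₒ-identityʳ : ∀ x → x +ₒ 𝟎 ≡ x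
+ₒ-identityʳ 𝟎 = refl
+ₒ-identityʳ (ω^ _ + _) = refl

+ₒ-absorb : ∀ a x c d → a <ₒ c → (ω^ a + x) +ₒ (ω^ c + d) ≡ ω^ c + d
+ₒ-absorb a x c d a<c rewrite a<c = refl

+ₒ-tail : ∀ a x c → lexp c ≤ₒ a → (ω^ a + x) +ₒ c ≡ ω^ a + (x +ₒ c)
+ₒ-tail a x 𝟎 _ = cong (ω^ a +_) (sym (+ₒ-identityʳ x))
+ₒ-tail a x (ω^ c + d) c≤a with compare a c in q
... | lt = ⊥-elim (≤ₒ⇒≯ₒ a c c≤a q)
... | eq = refl
... | gt = refl

lexp-+ₒ : ∀ x y {e} → lexp x ≤ₒ e → lexp y ≤ₒ e → lexp (x +ₒ y) ≤ₒ e
lexp-+ₒ 𝟎 y _ y≤e = y≤e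
lexp-+ₒ (ω^ a + x) 𝟎 x≤e _ = x≤e
lexp-+ₒ (ω^ a + x) (ω^ c + d) x≤e y≤e with compare a c
... | lt = y≤e
... | eq = x≤e
... | gt = x≤e

lexp-+ₒ-≥ˡ : ∀ x y → lexp x ≤ₒ lexp (x +ₒ y)
lexp-+ₒ-≥ˡ 𝟎 y = 𝟎≤ₒ (lexp y)
lexp-+ₒ-≥ˡ (ω^ a + x) 𝟎 = ≤ₒ-refl a
lexp-+ₒ-≥ˡ (ω^ a + x) (ω^ c + d) with compare a c in q
... | lt = inj₁ q
... | eq = ≤ₒ-refl a
... | gt = ≤ₒ-refl a

lexp-+ₒ-≥ʳ : ∀ x y → lexp y ≤ₒ lexp (x +ₒ y)
lexp-+ₒ-≥ʳ 𝟎 y = ≤ₒ-refl (lexp y)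
lexp-+ₒ-≥ʳ (ω^ a + x) 𝟎 = 𝟎≤ₒ a
lexp-+ₒ-≥ʳ (ω^ a + x) (ω^ c + d) with compare a c in q
... | lt = ≤ₒ-refl c
... | eq = inj₂ (compare-eq-sym a c q)
... | gt = inj₁ (compare-gt⇒lt a c q)

nf-+ₒ : ∀ {x y} → NF x → NF y → NF (x +ₒ y)
nf-+ₒ {𝟎} _ ny = ny
nf-+ₒ {ω^ a + x} {𝟎} nx _ = nx
nf-+ₒ {ω^ a + x} {ω^ c + d} nx ny with compare a c in q
... | lt = ny
... | eq = nf-ω^ (nf-head nx) (nf-+ₒ (nf-tail nx) ny)
              (lexp-+ₒ x (ω^ c + d) (nf-lexp nx) (inj₂ (compare-eq-sym a c q)))
... | gt = nf-ω^ (nf-head nx) (nf-+ₒ (nf-tail nx) ny)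
              (lexp-+ₒ x (ω^ c + d) (nf-lexp nx) (inj₁ (compare-gt⇒lt a c q)))

+ₒ-nonzeroʳ : ∀ x {y} → y ≢ 𝟎 → x +ₒ y ≢ 𝟎
+ₒ-nonzeroʳ 𝟎 y≢𝟎 = y≢𝟎
+ₒ-nonzeroʳ (ω^ a + x) {𝟎} y≢𝟎 = ⊥-elim (y≢𝟎 refl)
+ₒ-nonzeroʳ (ω^ a + x) {ω^ c + d} _ with compare a c
... | lt = λ ()
... | eq = λ ()
... | gt = λ ()

+ₒ-nonzeroˡ : ∀ {x} y → x ≢ 𝟎 → x +ₒ y ≢ 𝟎
+ₒ-nonzeroˡ {𝟎} y x≢𝟎 = ⊥-elim (x≢𝟎 refl)
+ₒ-nonzeroˡ {ω^ a + x} 𝟎 _ = λ ()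
+ₒ-nonzeroˡ {ω^ a + x} y@(ω^ _ + _) _ = +ₒ-nonzeroʳ (ω^ a + x) {y} λ ()

+ₒ-monoʳ-<ₒ : ∀ x c p → c <ₒ p → (x +ₒ c) <ₒ (x +ₒ p)
+ₒ-monoʳ-<ₒ 𝟎 c p c<p = c<p
+ₒ-monoʳ-<ₒ (ω^ a + x) c 𝟎 c<p = ⊥-elim (≮ₒ𝟎 c c<p)
+ₒ-monoʳ-<ₒ (ω^ a + x) c (ω^ p + p′) c<p with <ₒ-dec a p
... | inj₂ p≤a = subst₂ _<ₒ_
  (sym (+ₒ-tail a x c (≤ₒ-trans (lexp c) p a (lexp-mono c (ω^ p + p′) c<p) p≤a)))
  (sym (+ₒ-tail a x (ω^ p + p′) p≤a))
  (<ₒ-tail a (x +ₒ c) (x +ₒ (ω^ p + p′)) (+ₒ-monoʳ-<ₒ x c (ω^ p + p′) c<p))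
... | inj₁ a<p = subst (((ω^ a + x) +ₒ c) <ₒ_) (sym (+ₒ-absorb a x p p′ a<p)) (below c c<p)
  where
  below : ∀ c → c <ₒ (ω^ p + p′) → ((ω^ a + x) +ₒ c) <ₒ (ω^ p + p′)
  below 𝟎 _ = <ₒ-head a x p p′ a<p
  below (ω^ c + c′) c<p with <ₒ-dec a c
  ... | inj₁ a<c = subst (_<ₒ (ω^ p + p′)) (sym (+ₒ-absorb a x c c′ a<c)) c<p
  ... | inj₂ c≤a = subst (_<ₒ (ω^ p + p′)) (sym (+ₒ-tail a x (ω^ c + c′) c≤a)) (<ₒ-head a (x +ₒ (ω^ c + c′)) p p′ a<p)

+ₒ-cancelˡ-≤ₒ : ∀ x p c → (x +ₒ p) ≤ₒ (x +ₒ c) → p ≤ₒ c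
+ₒ-cancelˡ-≤ₒ x p c x+p≤x+c with <ₒ-dec c p
... | inj₁ c<p = ⊥-elim (≤ₒ⇒≯ₒ (x +ₒ c) (x +ₒ p) x+p≤x+c (+ₒ-monoʳ-<ₒ x c p c<p))
... | inj₂ p≤c = p≤c

≤ₒ⇒+ₒ-difference : ∀ {x b} → NF x → NF b → x ≤ₒ b → Σ[ c ∈ Tm ] NF c × x +ₒ c ≡ b
≤ₒ⇒+ₒ-difference {𝟎} {b} _ nb _ = b , nb , refl
≤ₒ⇒+ₒ-difference {ω^ _ + _} {𝟎} _ _ (inj₁ ())
≤ₒ⇒+ₒ-difference {ω^ _ + _} {𝟎} _ _ (inj₂ ())
≤ₒ⇒+ₒ-difference {ω^ a + x} {ω^ b + y} nx nb x≤y with compare a b in q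
... | lt = ω^ b + y , nb , +ₒ-absorb a x b y q
≤ₒ⇒+ₒ-difference {ω^ a + x} {ω^ b + y} nx nb (inj₁ ()) | gt
≤ₒ⇒+ₒ-difference {ω^ a + x} {ω^ b + y} nx nb (inj₂ ()) | gt
... | eq with compare-eq⇒≡ a b q
...   | refl with ≤ₒ⇒+ₒ-difference (nf-tail nx) (nf-tail nb) x≤y
...     | c , nc , x+c≡y = c , nc , (begin
  (ω^ a + x) +ₒ c  ≡⟨ +ₒ-tail a x c c≤a ⟩
  ω^ a + (x +ₒ c)  ≡⟨ cong (ω^ a +_) x+c≡y ⟩
  ω^ a + y         ∎)
  where
  open ≡-Reasoning
  c≤a : lexp c ≤ₒ a
  c≤a = ≤ₒ-trans (lexp c) (lexp (x +ₒ c)) a (lexp-+ₒ-≥ʳ x c) (subst (λ t → lexp t ≤ₒ a) (sym x+c≡y) (nf-lexp nb))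

ω^[_] : Tm → Tm
ω^[ x ] = ω^ x + 𝟎

nf-mulω : ∀ {α c} → NF α → NF c → NF (mulω α c)
nf-mulω {𝟎} nα _ = nf𝟎
nf-mulω {ω^ _ + _} {𝟎} nα _ = nα
nf-mulω {ω^ _ + _} {ω^ _ + _} nα nc = nf₁ (nf-+ₒ (nf-head nα) nc)

nf-·ₒ : ∀ {α β} → NF α → NF β → NF (α ·ₒ β)
nf-·ₒ {β = 𝟎} _ _ = nf𝟎
nf-·ₒ {β = ω^ _ + _} nα nβ = nf-+ₒ (nf-mulω nα (nf-head nβ)) (nf-·ₒ nα (nf-tail nβ))

mulω-nonzero : ∀ {α} c → α ≢ 𝟎 → mulω α c ≢ 𝟎
mulω-nonzero {𝟎} _ α≢𝟎 = ⊥-elim (α≢𝟎 refl)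
mulω-nonzero {ω^ _ + _} 𝟎 _ = λ ()
mulω-nonzero {ω^ _ + _} (ω^ _ + _) _ = λ ()

·ₒ-nonzero : ∀ {α β} → α ≢ 𝟎 → β ≢ 𝟎 → α ·ₒ β ≢ 𝟎
·ₒ-nonzero {β = 𝟎} _ β≢𝟎 = ⊥-elim (β≢𝟎 refl)
·ₒ-nonzero {α} {ω^ c + d} α≢𝟎 _ = +ₒ-nonzeroˡ (α ·ₒ d) (mulω-nonzero c α≢𝟎)

mulω-ω^ : ∀ x c → mulω ω^[ x ] c ≡ ω^[ x +ₒ c ]
mulω-ω^ x 𝟎 = cong ω^[_] (sym (+ₒ-identityʳ x))
mulω-ω^ x (ω^ _ + _) = refl

·ₒ-one : ∀ α → α ·ₒ oneₒ ≡ α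
·ₒ-one 𝟎 = refl
·ₒ-one (ω^ _ + _) = refl

lexp-ω^·ₒ : ∀ x p P → (x +ₒ p) ≤ₒ lexp (ω^[ x ] ·ₒ (ω^ p + P))
lexp-ω^·ₒ x p P = subst (_≤ₒ lexp (ω^[ x ] ·ₒ (ω^ p + P))) (cong lexp (mulω-ω^ x p))
  (lexp-+ₒ-≥ˡ (mulω ω^[ x ] p) (ω^[ x ] ·ₒ P))

nf-e^ : ∀ n {α} → NF α → NF (e^ n α)
nf-e^ zero nα = nα
nf-e^ (suc n) {α} nα with e^ n α | nf-e^ n nα
... | 𝟎 | _ = nf𝟎
... | ω^ _ + _ | nt = nf₁ nt

e¹-nonzero : ∀ {t} → t ≢ 𝟎 → e¹ t ≡ ω^[ t ]
e¹-nonzero {𝟎} t≢𝟎 = ⊥-elim (t≢𝟎 refl)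
e¹-nonzero {ω^ _ + _} _ = refl

e^-nonzero : ∀ n {α} → α ≢ 𝟎 → e^ n α ≢ 𝟎
e^-nonzero zero α≢𝟎 = α≢𝟎
e^-nonzero (suc n) α≢𝟎 rewrite e¹-nonzero (e^-nonzero n α≢𝟎) = λ ()

e^-positive : ∀ {m α} → 0 < m → α ≢ 𝟎 → e^ m α ≡ ω^[ e^ (m ∸ 1) α ]
e^-positive {suc j} _ α≢𝟎 = e¹-nonzero (e^-nonzero j α≢𝟎)

one≤ₒ : ∀ {t} → t ≢ 𝟎 → oneₒ ≤ₒ t
one≤ₒ {𝟎} t≢𝟎 = ⊥-elim (t≢𝟎 refl)
one≤ₒ {ω^ 𝟎 + 𝟎} _ = inj₂ refl
one≤ₒ {ω^ 𝟎 + (ω^ _ + _)} _ = inj₁ refl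
one≤ₒ {ω^ (ω^ _ + _) + _} _ = inj₁ refl

two+ₒ-finite : ∀ {d} → lexp d ≤ₒ 𝟎 → twoₒ +ₒ d ≡ ω^ 𝟎 + (ω^ 𝟎 + d)
two+ₒ-finite {𝟎} _ = refl
two+ₒ-finite {ω^ 𝟎 + _} _ = refl
two+ₒ-finite {ω^ (ω^ _ + _) + _} (inj₁ ())
two+ₒ-finite {ω^ (ω^ _ + _) + _} (inj₂ ())

one+ₒ-one+ₒ : ∀ δ → oneₒ +ₒ (oneₒ +ₒ δ) ≡ twoₒ +ₒ δ
one+ₒ-one+ₒ 𝟎 = refl
one+ₒ-one+ₒ (ω^ 𝟎 + _) = refl
one+ₒ-one+ₒ (ω^ (ω^ _ + _) + _) = refl

one+ₒ-as-two+ₒ : ∀ {α} → NF α → α ≢ 𝟎 → Σ[ δ ∈ Tm ] NF δ × oneₒ +ₒ α ≡ twoₒ +ₒ δ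
one+ₒ-as-two+ₒ {𝟎} _ α≢𝟎 = ⊥-elim (α≢𝟎 refl)
one+ₒ-as-two+ₒ {ω^ 𝟎 + x} nα _ = x , nf-tail nα , sym (two+ₒ-finite (nf-lexp nα))
one+ₒ-as-two+ₒ {α@(ω^ (ω^ _ + _) + _)} nα _ = α , nα , refl

two-terms-as-two+ₒ : ∀ {c γ} → NF (ω^ c + γ) → γ ≢ 𝟎 → Σ[ δ ∈ Tm ] NF δ × ω^ c + γ ≡ twoₒ +ₒ δ
two-terms-as-two+ₒ {γ = 𝟎} _ γ≢𝟎 = ⊥-elim (γ≢𝟎 refl)
two-terms-as-two+ₒ {𝟎} {ω^ e + d} n _ with ≤ₒ𝟎⇒≡𝟎 e (nf-lexp n)
... | refl = d , nf-tail (nf-tail n) , sym (two+ₒ-finite (nf-lexp (nf-tail n)))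
two-terms-as-two+ₒ {c@(ω^ _ + _)} {γ@(ω^ _ + _)} n _ = ω^ c + γ , n , refl

AbsorbsOrMultiple : Tm → Tm → Set
AbsorbsOrMultiple ρ E = (ρ +ₒ E ≡ E) ⊎ Σ[ δ ∈ Tm ] NF δ × ρ +ₒ E ≡ E ·ₒ (twoₒ +ₒ δ)

ω^-prepend : ∀ {x b ρ γ} → NF x → x ≤ₒ b → NF (ω^ b + ρ) → NF γ → γ ≢ 𝟎 →
  ρ +ₒ ω^[ x ] ≡ ω^[ x ] ·ₒ γ →
  Σ[ c ∈ Tm ] NF (ω^ c + γ) × (ω^ b + ρ) +ₒ ω^[ x ] ≡ ω^[ x ] ·ₒ (ω^ c + γ)
ω^-prepend {γ = 𝟎} _ _ _ _ γ≢𝟎 _ = ⊥-elim (γ≢𝟎 refl)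
ω^-prepend {x} {b} {ρ} {γ@(ω^ p + P)} nx x≤b nbρ nγ _ ρ+ω^x≡ω^x·γ
  with ≤ₒ⇒+ₒ-difference nx (nf-head nbρ) x≤b
... | c , nc , x+c≡b = c , nf-ω^ nc nγ p≤c , (begin
  (ω^ b + ρ) +ₒ ω^[ x ]           ≡⟨ +ₒ-tail b ρ ω^[ x ] x≤b ⟩
  ω^ b + (ρ +ₒ ω^[ x ])           ≡⟨ cong (ω^ b +_) ρ+ω^x≡ω^x·γ ⟩
  ω^ b + (ω^[ x ] ·ₒ γ)           ≡⟨ sym (+ₒ-tail b 𝟎 (ω^[ x ] ·ₒ γ) lexp≤b) ⟩
  ω^[ b ] +ₒ (ω^[ x ] ·ₒ γ)       ≡⟨ cong (λ t → ω^[ t ] +ₒ (ω^[ x ] ·ₒ γ)) (sym x+c≡b) ⟩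
  ω^[ x +ₒ c ] +ₒ (ω^[ x ] ·ₒ γ)  ≡⟨ cong (_+ₒ (ω^[ x ] ·ₒ γ)) (sym (mulω-ω^ x c)) ⟩
  ω^[ x ] ·ₒ (ω^ c + γ)           ∎)
  where
  open ≡-Reasoning
  lexp≤b : lexp (ω^[ x ] ·ₒ γ) ≤ₒ b
  lexp≤b = subst (λ t → lexp t ≤ₒ b) ρ+ω^x≡ω^x·γ (lexp-+ₒ ρ ω^[ x ] (nf-lexp nbρ) x≤b)
  p≤c : p ≤ₒ c
  p≤c = +ₒ-cancelˡ-≤ₒ x p c (≤ₒ-trans (x +ₒ p) (lexp (ω^[ x ] ·ₒ γ)) (x +ₒ c)
          (lexp-ω^·ₒ x p P) (subst (lexp (ω^[ x ] ·ₒ γ) ≤ₒ_) (sym x+c≡b) lexp≤b))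

absorbs-or-multiple⇒multiple : ∀ {ρ E} → AbsorbsOrMultiple ρ E →
  Σ[ γ ∈ Tm ] NF γ × γ ≢ 𝟎 × ρ +ₒ E ≡ E ·ₒ γ
absorbs-or-multiple⇒multiple {E = E} (inj₁ ρ+E≡E) = oneₒ , nf-one , (λ ()) , trans ρ+E≡E (sym (·ₒ-one E))
absorbs-or-multiple⇒multiple (inj₂ (δ , nδ , e)) = twoₒ +ₒ δ , nf-+ₒ nf-two nδ , +ₒ-nonzeroˡ {twoₒ} δ (λ ()) , e

+ₒ-ω^-absorbs-or-multiple : ∀ {x ρ} → NF x → NF ρ → AbsorbsOrMultiple ρ ω^[ x ]
+ₒ-ω^-absorbs-or-multiple {x} {𝟎} _ _ = inj₁ refl
+ₒ-ω^-absorbs-or-multiple {x} {ω^ b + ρ} nx nbρ with <ₒ-dec b x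
... | inj₁ b<x = inj₁ (+ₒ-absorb b ρ x 𝟎 b<x)
... | inj₂ x≤b with absorbs-or-multiple⇒multiple {ρ} (+ₒ-ω^-absorbs-or-multiple nx (nf-tail nbρ))
... | γ , nγ , γ≢𝟎 , e with ω^-prepend {x} {b} {ρ} nx x≤b nbρ nγ γ≢𝟎 e
... | c , ncγ , e′ with two-terms-as-two+ₒ ncγ γ≢𝟎
... | δ , nδ , cγ≡2+δ = inj₂ (δ , nδ , trans e′ (cong (ω^[ x ] ·ₒ_) cγ≡2+δ))

wf-⟨⟩ : ∀ {n} α {φ} → NF α → WF φ → WF (⟨ n ^ α ⟩ φ)
wf-⟨⟩ 𝟎 _ wφ = wφ
wf-⟨⟩ (ω^ _ + _) nα wφ = wf◇ nα wφ

head-nonzero : ∀ {φ h a} → HasHead φ h a → a ≢ 𝟎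
head-nonzero (hd₁ a≢𝟎) = a≢𝟎
head-nonzero (hd₂ a≢𝟎) = a≢𝟎

head-nf : ∀ {φ h a} → WF φ → HasHead φ h a → NF a
head-nf w hh = nf-of-⟨⟩ (head-nonzero hh) (monomial-wf w hh)
  where
  nf-of-⟨⟩ : ∀ {n a φ} → a ≢ 𝟎 → WF (⟨ n ^ a ⟩ φ) → NF a
  nf-of-⟨⟩ {a = 𝟎} a≢𝟎 _ = ⊥-elim (a≢𝟎 refl)
  nf-of-⟨⟩ {a = ω^ _ + _} _ (wf◇ na _) = na
  monomial-wf : ∀ {φ h a} → WF φ → HasHead φ h a → WF (⟨ h ^ a ⟩ ⊤')
  monomial-wf w (hd₁ _) = w
  monomial-wf (wf∧ w _) (hd₂ _) = w

wf-mnf : ∀ {ψ} → MNF ψ → WF ψ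
wf-mnf top = wf⊤
wf-mnf (mono {α = α} nα _) = wf-⟨⟩ α nα wf⊤
wf-mnf (ext {n = n} {n₀} mχ hh _ nβ) =
  wf∧ (wf-⟨⟩ _ (nf-·ₒ (nf-e^ (n₀ ∸ n) (head-nf (wf-mnf mχ) hh)) (nf-+ₒ nf-two nβ)) wf⊤) (wf-mnf mχ)

⊢-head : ∀ {χ h a} → WF χ → HasHead χ h a → χ ⊢ ⟨ h ^ a ⟩ ⊤'
⊢-head w (hd₁ _) = ax-id w
⊢-head (wf∧ w v) (hd₂ _) = ax-∧l w v

≡ᵀ-refl : ∀ {φ} → WF φ → φ ≡ᵀ φ
≡ᵀ-refl w = ax-id w , ax-id w

≡ᵀ-trans : ∀ {φ ψ χ} → φ ≡ᵀ ψ → ψ ≡ᵀ χ → φ ≡ᵀ χ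
≡ᵀ-trans (φ⊢ψ , ψ⊢φ) (ψ⊢χ , χ⊢ψ) = r-cut φ⊢ψ ψ⊢χ , r-cut χ⊢ψ ψ⊢φ

⟨⟩-cong : ∀ {n α φ ψ} → NF α → φ ≡ᵀ ψ → (⟨ n ^ α ⟩ φ) ≡ᵀ (⟨ n ^ α ⟩ ψ)
⟨⟩-cong nα (φ⊢ψ , ψ⊢φ) = r-◇ nα φ⊢ψ , r-◇ nα ψ⊢φ

∧-congˡ : ∀ {θ φ ψ} → WF θ → WF φ → WF ψ → φ ≡ᵀ ψ → (θ ∧' φ) ≡ᵀ (θ ∧' ψ)
∧-congˡ wθ wφ wψ (φ⊢ψ , ψ⊢φ) =
  r-∧ (ax-∧l wθ wφ) (r-cut (ax-∧r wθ wφ) φ⊢ψ) , r-∧ (ax-∧l wθ wψ) (r-cut (ax-∧r wθ wψ) ψ⊢φ)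

∧-comm : ∀ {φ ψ} → WF φ → WF ψ → φ ∧' ψ ⊢ ψ ∧' φ
∧-comm wφ wψ = r-∧ (ax-∧r wφ wψ) (ax-∧l wφ wψ)

∧-identityʳ : ∀ {φ} → WF φ → φ ≡ᵀ (φ ∧' ⊤')
∧-identityʳ w = r-∧ (ax-id w) (ax-top w) , ax-∧l w wf⊤

∧-redundant : ∀ {φ χ} → WF φ → WF χ → χ ⊢ φ → (φ ∧' χ) ≡ᵀ χ
∧-redundant wφ wχ χ⊢φ = ax-∧r wφ wχ , r-∧ χ⊢φ (ax-id wχ)

⟨⟩-drop : ∀ {n α φ} → WF φ → NF α → ⟨ n ^ α ⟩ φ ⊢ φ
⟨⟩-drop {α = α} w nα = ax-mono w nα nf𝟎 (𝟎≤ₒ α)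

⟨⟩-∘ : ∀ {n α β φ} → WF φ → NF α → NF β → (⟨ n ^ β ⟩ (⟨ n ^ α ⟩ φ)) ≡ᵀ (⟨ n ^ (α +ₒ β) ⟩ φ)
⟨⟩-∘ w nα nβ = ax-add← w nα nβ , ax-add→ w nα nβ

⟨⟩-+ₒ-weaken : ∀ {n α β φ} → WF φ → NF α → NF β → ⟨ n ^ (α +ₒ β) ⟩ φ ⊢ ⟨ n ^ α ⟩ φ
⟨⟩-+ₒ-weaken {n} {α} w nα nβ = r-cut (ax-add→ w nα nβ) (⟨⟩-drop (wf-⟨⟩ {n} α nα w) nβ)

⟨⟩-lower : ∀ {k n α φ} → k ≤ n → WF φ → NF α → ⟨ n ^ α ⟩ φ ⊢ ⟨ k ^ e^ (n ∸ k) α ⟩ φ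
⟨⟩-lower {k} {n} {α} {φ} k≤n w nα =
  subst (λ m → ⟨ m ^ α ⟩ φ ⊢ ⟨ k ^ e^ (n ∸ k) α ⟩ φ) (m+[n∸m]≡n k≤n) (ax-red w nα)

schmerl : ∀ {χ n n₀ α₀ α} → MNF χ → HasHead χ n₀ α₀ → n < n₀ → NF α →
  (⟨ n ^ α ⟩ χ) ≡ᵀ (⟨ n ^ (e^ (n₀ ∸ n) α₀ ·ₒ (oneₒ +ₒ α)) ⟩ ⊤' ∧' χ)
schmerl mχ hh n<n₀ nα = ax-sch→ mχ hh n<n₀ nα , ax-sch← mχ hh n<n₀ nα

-- The successor exponent B + 1 is what r-pull needs to move the monomial back under ⟨n^α⟩.
⟨⟩-extract : ∀ {k n α B χ} → k < n → NF α → α ≢ 𝟎 → NF B → WF χ →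
  (⟨ n ^ α ⟩ (⟨ k ^ B ⟩ ⊤' ∧' χ)) ≡ᵀ (⟨ k ^ (B +ₒ oneₒ) ⟩ ⊤' ∧' ⟨ n ^ α ⟩ χ)
⟨⟩-extract {k} {n} {α} {B} {χ} k<n nα α≢𝟎 nB wχ = r-∧ to-lower to-upper , from
  where
  wB : WF (⟨ k ^ B ⟩ ⊤')
  wB = wf-⟨⟩ {k} B nB wf⊤
  wB∧χ : WF (⟨ k ^ B ⟩ ⊤' ∧' χ)
  wB∧χ = wf∧ wB wχ
  wB+1 : WF (⟨ k ^ (B +ₒ oneₒ) ⟩ ⊤')
  wB+1 = wf-⟨⟩ {k} (B +ₒ oneₒ) (nf-+ₒ nB nf-one) wf⊤
  to-lower : ⟨ n ^ α ⟩ (⟨ k ^ B ⟩ ⊤' ∧' χ) ⊢ ⟨ k ^ (B +ₒ oneₒ) ⟩ ⊤'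
  to-lower = r-cut (⟨⟩-lower (<⇒≤ k<n) wB∧χ nα)
    (r-cut (ax-mono wB∧χ (nf-e^ (n ∸ k) nα) nf-one (one≤ₒ (e^-nonzero (n ∸ k) α≢𝟎)))
    (r-cut (r-◇ nf-one (ax-∧l wB wχ)) (ax-add← wf⊤ nB nf-one)))
  to-upper : ⟨ n ^ α ⟩ (⟨ k ^ B ⟩ ⊤' ∧' χ) ⊢ ⟨ n ^ α ⟩ χ
  to-upper = r-◇ nα (ax-∧r wB wχ)
  from : ⟨ k ^ (B +ₒ oneₒ) ⟩ ⊤' ∧' ⟨ n ^ α ⟩ χ ⊢ ⟨ n ^ α ⟩ (⟨ k ^ B ⟩ ⊤' ∧' χ)
  from = r-cut (∧-comm wB+1 (wf-⟨⟩ {n} α nα wχ))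
    (r-cut (r-pull k<n nα nB (ax-top wχ))
    (r-◇ nα (r-∧ (r-cut (ax-∧r wχ wB+1) (⟨⟩-+ₒ-weaken wf⊤ nB nf-one)) (ax-∧l wχ wB+1))))

-- r-pull moves ⟨k^ρ⟩⊤ under the head ⟨h^a⟩ of χ, which then reduces to ⟨k^(e^(h-k) a)⟩.
∧-absorb-lowered-head : ∀ {k h a B χ} → k < h → NF a → NF B → WF χ → HasHead χ h a →
  (⟨ k ^ (B +ₒ oneₒ) ⟩ ⊤' ∧' χ) ≡ᵀ (⟨ k ^ ((B +ₒ oneₒ) +ₒ e^ (h ∸ k) a) ⟩ ⊤' ∧' χ)
∧-absorb-lowered-head {k} {h} {a} {B} {χ} k<h na nB wχ hh =
  r-∧ (r-cut lift-head merge) (ax-∧r wρ wχ) ,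
  r-∧ (r-cut (ax-∧l wρ+E wχ) (⟨⟩-+ₒ-weaken wf⊤ nρ nE)) (ax-∧r wρ+E wχ)
  where
  ρ E : Tm
  ρ = B +ₒ oneₒ
  E = e^ (h ∸ k) a
  nρ : NF ρ
  nρ = nf-+ₒ nB nf-one
  nE : NF E
  nE = nf-e^ (h ∸ k) na
  wρ : WF (⟨ k ^ ρ ⟩ ⊤')
  wρ = wf-⟨⟩ {k} ρ nρ wf⊤
  wρ+E : WF (⟨ k ^ (ρ +ₒ E) ⟩ ⊤')
  wρ+E = wf-⟨⟩ {k} (ρ +ₒ E) (nf-+ₒ nρ nE) wf⊤
  lift-head : ⟨ k ^ ρ ⟩ ⊤' ∧' χ ⊢ ⟨ h ^ a ⟩ (⟨ k ^ ρ ⟩ ⊤')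
  lift-head = r-cut (r-∧ (r-cut (ax-∧r wρ wχ) (⊢-head wχ hh)) (ax-∧l wρ wχ))
    (r-cut (r-pull k<h na nB (ax-top wf⊤)) (r-◇ na (ax-∧r wf⊤ wρ)))
  merge : ⟨ h ^ a ⟩ (⟨ k ^ ρ ⟩ ⊤') ⊢ ⟨ k ^ (ρ +ₒ E) ⟩ ⊤'
  merge = r-cut (⟨⟩-lower (<⇒≤ k<h) wρ na) (ax-add← wf⊤ nρ nE)

Above : ℕ → Fm → Set
Above m φ = φ ≡ ⊤' ⊎ Σ[ h ∈ ℕ ] Σ[ a ∈ Tm ] HasHead φ h a × m < h

MNFWithHead≥ : ℕ → Fm → Set
MNFWithHead≥ n φ = Σ[ θ ∈ Fm ] MNF θ × (φ ≡ᵀ θ) × (∀ {m} → m < n → Above m θ)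

MNFWithHead≥-resp-≡ᵀ : ∀ {n φ ψ} → φ ≡ᵀ ψ → MNFWithHead≥ n ψ → MNFWithHead≥ n φ
MNFWithHead≥-resp-≡ᵀ φ≡ψ (θ , mθ , ψ≡θ , above) = θ , mθ , ≡ᵀ-trans φ≡ψ ψ≡θ , above

head-index-unique : ∀ {φ h h′ a a′} → HasHead φ h a → HasHead φ h′ a′ → h ≡ h′
head-index-unique hh hh′ = trans (sym (index hh)) (index hh′)
  where
  headIndex : Fm → ℕ
  headIndex (◇ n _ _) = n
  headIndex (◇ n _ _ ∧' _) = n
  headIndex _ = 0
  index : ∀ {φ h a} → HasHead φ h a → headIndex φ ≡ h
  index (hd₁ {α₀ = 𝟎} a≢𝟎) = ⊥-elim (a≢𝟎 refl)
  index (hd₁ {α₀ = ω^ _ + _} _) = refl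
  index (hd₂ {α₀ = 𝟎} a≢𝟎) = ⊥-elim (a≢𝟎 refl)
  index (hd₂ {α₀ = ω^ _ + _} _) = refl

Above⇒<head : ∀ {m φ h a} → HasHead φ h a → Above m φ → m < h
Above⇒<head (hd₁ {α₀ = 𝟎} a≢𝟎) _ = ⊥-elim (a≢𝟎 refl)
Above⇒<head (hd₁ {α₀ = ω^ _ + _} _) (inj₁ ())
Above⇒<head (hd₂ _) (inj₁ ())
Above⇒<head {m} hh (inj₂ (_ , _ , hh′ , m<h′)) = subst (m <_) (head-index-unique hh′ hh) m<h′

ext-hasHead : ∀ {χ n n₀ α₀ δ} → HasHead χ n₀ α₀ →
  HasHead (⟨ n ^ (e^ (n₀ ∸ n) α₀ ·ₒ (twoₒ +ₒ δ)) ⟩ ⊤' ∧' χ) n (e^ (n₀ ∸ n) α₀ ·ₒ (twoₒ +ₒ δ))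
ext-hasHead {n = n} {n₀} {δ = δ} hh =
  hd₂ (·ₒ-nonzero (e^-nonzero (n₀ ∸ n) (head-nonzero hh)) (+ₒ-nonzeroˡ {twoₒ} δ (λ ())))

schmerl-mnf : ∀ {χ k β n α} → MNF χ → HasHead χ k β → n < k → NF α → α ≢ 𝟎 →
  MNFWithHead≥ n (⟨ n ^ α ⟩ χ)
schmerl-mnf {χ} {k} {β} {n} {α} mχ hh n<k nα α≢𝟎 with one+ₒ-as-two+ₒ nα α≢𝟎
... | δ , nδ , 1+α≡2+δ =
  _ , ext mχ hh n<k nδ ,
  subst (λ γ → (⟨ n ^ α ⟩ χ) ≡ᵀ (⟨ n ^ (e^ (k ∸ n) β ·ₒ γ) ⟩ ⊤' ∧' χ)) 1+α≡2+δ (schmerl mχ hh n<k nα) ,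
  λ m<n → inj₂ (n , _ , ext-hasHead {δ = δ} hh , m<n)

∧-lower-monomial : ∀ {k B χ} → NF B → MNF χ → Above k χ →
  MNFWithHead≥ k (⟨ k ^ (B +ₒ oneₒ) ⟩ ⊤' ∧' χ)
∧-lower-monomial {k} {B} nB _ (inj₁ refl) =
  _ , mono nρ ρ≢𝟎 , swap (∧-identityʳ (wf-⟨⟩ {k} (B +ₒ oneₒ) nρ wf⊤)) ,
  λ m<k → inj₂ (k , _ , hd₁ ρ≢𝟎 , m<k)
  where
  nρ : NF (B +ₒ oneₒ)
  nρ = nf-+ₒ nB nf-one
  ρ≢𝟎 : B +ₒ oneₒ ≢ 𝟎
  ρ≢𝟎 = +ₒ-nonzeroʳ B (λ ())
∧-lower-monomial {k} {B} {χ} nB mχ (inj₂ (h , a , hh , k<h)) =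
  MNFWithHead≥-resp-≡ᵀ (∧-absorb-lowered-head k<h na nB wχ hh) (by-cases sum-shape)
  where
  ρ E : Tm
  ρ = B +ₒ oneₒ
  E = e^ (h ∸ k) a
  wχ : WF χ
  wχ = wf-mnf mχ
  na : NF a
  na = head-nf wχ hh
  sum-shape : AbsorbsOrMultiple ρ E
  sum-shape = subst (AbsorbsOrMultiple ρ) (sym (e^-positive (m<n⇒0<n∸m k<h) (head-nonzero hh)))
    (+ₒ-ω^-absorbs-or-multiple (nf-e^ (h ∸ k ∸ 1) na) (nf-+ₒ nB nf-one))
  by-cases : AbsorbsOrMultiple ρ E → MNFWithHead≥ k (⟨ k ^ (ρ +ₒ E) ⟩ ⊤' ∧' χ)
  by-cases (inj₁ ρ+E≡E) =
    χ , mχ ,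
    subst (λ σ → (⟨ k ^ σ ⟩ ⊤' ∧' χ) ≡ᵀ χ) (sym ρ+E≡E)
      (∧-redundant (wf-⟨⟩ {k} E (nf-e^ (h ∸ k) na) wf⊤) wχ (r-cut (⊢-head wχ hh) (⟨⟩-lower (<⇒≤ k<h) wf⊤ na))) ,
    λ m<k → inj₂ (h , a , hh , <-trans m<k k<h)
  by-cases (inj₂ (δ , nδ , ρ+E≡E·2+δ)) =
    subst (λ σ → MNFWithHead≥ k (⟨ k ^ σ ⟩ ⊤' ∧' χ)) (sym ρ+E≡E·2+δ)
      (_ , ext mχ hh k<h nδ , ≡ᵀ-refl (wf-mnf (ext mχ hh k<h nδ)) ,
       λ m<k → inj₂ (k , _ , ext-hasHead {δ = δ} hh , m<k))

prefix-past-head : ∀ {k n α B χ χ′} → k < n → NF α → α ≢ 𝟎 → NF B → WF χ →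
  MNF χ′ → (⟨ n ^ α ⟩ χ) ≡ᵀ χ′ → Above k χ′ →
  MNFWithHead≥ k (⟨ n ^ α ⟩ (⟨ k ^ B ⟩ ⊤' ∧' χ))
prefix-past-head {k} {n} {α} {B} k<n nα α≢𝟎 nB wχ mχ′ nαχ≡χ′ above = MNFWithHead≥-resp-≡ᵀ
  (≡ᵀ-trans (⟨⟩-extract k<n nα α≢𝟎 nB wχ)
    (∧-congˡ (wf-⟨⟩ {k} (B +ₒ oneₒ) (nf-+ₒ nB nf-one) wf⊤) (wf-⟨⟩ {n} α nα wχ) (wf-mnf mχ′) nαχ≡χ′))
  (∧-lower-monomial nB mχ′ above)

ext-as-⟨⟩ : ∀ {χ k n₀ α₀ δ} → MNF χ → HasHead χ n₀ α₀ → k < n₀ → NF δ →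
  (⟨ k ^ (e^ (n₀ ∸ k) α₀ ·ₒ (twoₒ +ₒ δ)) ⟩ ⊤' ∧' χ) ≡ᵀ (⟨ k ^ (oneₒ +ₒ δ) ⟩ χ)
ext-as-⟨⟩ {χ} {k} {n₀} {α₀} {δ} mχ hh k<n₀ nδ = swap
  (subst (λ γ → (⟨ k ^ (oneₒ +ₒ δ) ⟩ χ) ≡ᵀ (⟨ k ^ (e^ (n₀ ∸ k) α₀ ·ₒ γ) ⟩ ⊤' ∧' χ)) (one+ₒ-one+ₒ δ)
    (schmerl mχ hh k<n₀ (nf-+ₒ nf-one nδ)))

-- The invariant lets the recursion on the tail of an MNF feed ∧-lower-monomial.
PrefixMNF : ℕ → Tm → Fm → Set
PrefixMNF n α ψ = Σ[ ψ′ ∈ Fm ] MNF ψ′ × ((⟨ n ^ α ⟩ ψ) ≡ᵀ ψ′) × (∀ {m} → m < n → Above m ψ → Above m ψ′)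

at-head : ∀ {n α ψ} → MNFWithHead≥ n (⟨ n ^ α ⟩ ψ) → PrefixMNF n α ψ
at-head (ψ′ , mψ′ , e , above) = ψ′ , mψ′ , e , λ m<n _ → above m<n

past-head : ∀ {k n α ψ B} → HasHead ψ k B → MNFWithHead≥ k (⟨ n ^ α ⟩ ψ) → PrefixMNF n α ψ
past-head hh (ψ′ , mψ′ , e , above) = ψ′ , mψ′ , e , λ _ abψ → above (Above⇒<head hh abψ)

prefix-mnf : ∀ {ψ} → MNF ψ → ∀ n α → NF α → PrefixMNF n α ψ
prefix-mnf mψ n 𝟎 _ = _ , mψ , ≡ᵀ-refl (wf-mnf mψ) , λ _ above → above
prefix-mnf top n α@(ω^ _ + _) nα =
  at-head (_ , mono nα (λ ()) , ≡ᵀ-refl (wf◇ nα wf⊤) , λ m<n → inj₂ (n , α , hd₁ (λ ()) , m<n))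
prefix-mnf (mono {k} {β} nβ β≢𝟎) n α@(ω^ _ + _) nα with <-cmp n k
... | tri< n<k _ _ = at-head (schmerl-mnf (mono nβ β≢𝟎) (hd₁ β≢𝟎) n<k nα (λ ()))
... | tri≈ _ refl _ =
  at-head (_ , mono (nf-+ₒ nβ nα) β+α≢𝟎 , ⟨⟩-∘ wf⊤ nβ nα , λ m<k → inj₂ (k , _ , hd₁ β+α≢𝟎 , m<k))
  where
  β+α≢𝟎 : β +ₒ α ≢ 𝟎
  β+α≢𝟎 = +ₒ-nonzeroʳ β {α} (λ ())
... | tri> _ _ k<n = past-head (hd₁ β≢𝟎)
  (MNFWithHead≥-resp-≡ᵀ (⟨⟩-cong nα (∧-identityʳ (wf-⟨⟩ {k} β nβ wf⊤)))
    (prefix-past-head k<n nα (λ ()) nβ wf⊤ (mono nα (λ ())) (≡ᵀ-refl (wf◇ nα wf⊤))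
      (inj₂ (n , α , hd₁ (λ ()) , k<n))))
prefix-mnf (ext {χ} {k} {n₀} {α₀} {δ} mχ hh k<n₀ nδ) n α@(ω^ _ + _) nα with <-cmp n k
... | tri< n<k _ _ = at-head (schmerl-mnf (ext mχ hh k<n₀ nδ) (ext-hasHead {δ = δ} hh) n<k nα (λ ()))
... | tri≈ _ refl _ = at-head (MNFWithHead≥-resp-≡ᵀ
  (≡ᵀ-trans (⟨⟩-cong nα (ext-as-⟨⟩ mχ hh k<n₀ nδ)) (⟨⟩-∘ (wf-mnf mχ) (nf-+ₒ nf-one nδ) nα))
  (schmerl-mnf mχ hh k<n₀ (nf-+ₒ (nf-+ₒ nf-one nδ) nα) (+ₒ-nonzeroʳ (oneₒ +ₒ δ) {α} (λ ()))))
... | tri> _ _ k<n with prefix-mnf mχ n α nα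
... | χ′ , mχ′ , nαχ≡χ′ , keeps-above = past-head (ext-hasHead {δ = δ} hh)
  (prefix-past-head k<n nα (λ ()) nB (wf-mnf mχ) mχ′ nαχ≡χ′ (keeps-above k<n (inj₂ (n₀ , α₀ , hh , k<n₀))))
  where
  nB : NF (e^ (n₀ ∸ k) α₀ ·ₒ (twoₒ +ₒ δ))
  nB = nf-·ₒ (nf-e^ (n₀ ∸ k) (head-nf (wf-mnf mχ) hh)) (nf-+ₒ nf-two nδ)

theorem5p9 : (ψ : Fm) → MNF ψ → (n : ℕ) → (α : Tm) → NF α →
    Σ Fm (λ ψ' → MNF ψ' × ((⟨ n ^ α ⟩ ψ) ≡ᵀ ψ'))
theorem5p9 ψ mψ n α nα with prefix-mnf mψ n α nα
... | ψ′ , mψ′ , ⟨n^α⟩ψ≡ψ′ , _ = ψ′ , mψ′ , ⟨n^α⟩ψ≡ψ′
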